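{- Let $G=(V,E)$ be a finite, simple, undirected graph, and for $v\in V$ let $N(v)$ denote the open neighborhood of $v$. Consider the integer linear program \[ \min \sum_{v\in V} x_v + 2\sum_{v\in V} y_v + 3\sum_{v\in V} z_v \] subject to, for every $v\in V$: \[ x_v+y_v+z_v+\tfrac12\sum_{u\in N(v)} y_u+\sum_{u\in N(v)} z_u\ \ge 1,\qquad \sum_{u\in N(v)} y_u+\sum_{u\in N(v)} z_u\ \ge x_v,\qquad x_v+y_v+z_v\le 1,\qquad x_v,y_v,z_v\in\{0,1\}. \] Then the optimal objective value of this program equals the double Roman domination number $\gamma_{dR}(G)$.
   Context: A double Roman dominating function (DRDF) on a graph $G=(V,E)$ is a function $f:V\to\{0,1,2,3\}$ such that: if $f(v)=0$ then $v$ has at least two neighbors $u$ with $f(u)=2$ or at least one neighbor $u$ with $f(u)=3$; and if $f(v)=1$ then $v$ has at least one neighbor $u$ with $f(u)\ge 2$. The weight of $f$ is $\sum_{v\in V} f(v)$, and the double Roman domination number $\gamma_{dR}(G)$ is the minimum weight of a DRDF on $G$. -}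

module Defs where

open import Data.Nat using (ℕ; zero; suc; _+_; _*_; _≤_)
open import Data.Fin using (Fin; zero; suc)
open import Data.Bool using (Bool; true; false; if_then_else_)
open import Data.Product using (Σ; _×_; ∃; ∃-syntax)
open import Data.Sum using (_⊎_)
open import Relation.Binary.PropositionalEquality using (_≡_; _≢_)

record Graph (n : ℕ) : Set where
  field
    adj     : Fin n → Fin n → Bool
    sym     : ∀ u v → adj u v ≡ adj v u
    irrefl  : ∀ v → adj v v ≡ false
open Graph public

_∈N[_]_ : ∀ {n} → Fin n → Graph n → Fin n → Set
u ∈N[ G ] v = adj G v u ≡ true

sumF : ∀ {n} → (Fin n → ℕ) → ℕ
sumF {zero}  f = 0
sumF {suc n} f = f zero + sumF (λ i → f (suc i))

sumN : ∀ {n} → Graph n → Fin n → (Fin n → ℕ) → ℕ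
sumN G v f = sumF (λ u → if adj G v u then f u else 0)

record IsDRDF {n} (G : Graph n) (f : Fin n → ℕ) : Set where
  field
    range : ∀ v → f v ≤ 3
    zero-cond : ∀ v → f v ≡ 0 →
      (Σ (Fin n) λ u → Σ (Fin n) λ w →
          u ≢ w × u ∈N[ G ] v × w ∈N[ G ] v × f u ≡ 2 × f w ≡ 2)
      ⊎ (Σ (Fin n) λ u → u ∈N[ G ] v × f u ≡ 3)
    one-cond : ∀ v → f v ≡ 1 →
      Σ (Fin n) λ u → u ∈N[ G ] v × 2 ≤ f u

weight : ∀ {n} → (Fin n → ℕ) → ℕ
weight f = sumF f

IsDRDNumber : ∀ {n} → Graph n → ℕ → Set
IsDRDNumber {n} G k =
  (Σ (Fin n → ℕ) λ f → IsDRDF G f × weight f ≡ k)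
  × (∀ f → IsDRDF G f → k ≤ weight f)

record Feasible {n} (G : Graph n) (x y z : Fin n → ℕ) : Set where
  field
    x-bin : ∀ v → x v ≤ 1
    y-bin : ∀ v → y v ≤ 1
    z-bin : ∀ v → z v ≤ 1
    -- x_v + y_v + z_v + ½ Σ_{N(v)} y + Σ_{N(v)} z ≥ 1, multiplied by 2
    c1 : ∀ v → 2 ≤ 2 * (x v + y v + z v) + sumN G v y + 2 * sumN G v z
    c2 : ∀ v → x v ≤ sumN G v y + sumN G v z
    c3 : ∀ v → x v + y v + z v ≤ 1

objective : ∀ {n} → (x y z : Fin n → ℕ) → ℕ
objective x y z = sumF x + 2 * sumF y + 3 * sumF z

IsILPOptimum : ∀ {n} → Graph n → ℕ → Set
IsILPOptimum {n} G k =
  (Σ (Fin n → ℕ) λ x → Σ (Fin n → ℕ) λ y → Σ (Fin n → ℕ) λ z →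
     Feasible G x y z × objective x y z ≡ k)
  × (∀ x y z → Feasible G x y z → k ≤ objective x y z)

-- Labelling a vertex 1, 2 or 3 is the same as setting exactly one of x_v, y_v, z_v to 1, and
-- under this encoding the objective is the weight. The first ILP constraint says that a vertex
-- labelled 0 sees neighbours labelled 2 twice or a neighbour labelled 3 (y counts 1/2, z counts 1);
-- the second says that a vertex labelled 1 sees a neighbour labelled 2 or 3. Hence feasible
-- solutions and DRDFs correspond weight-preservingly, so both optima are the least weight of a
-- DRDF, which exists since DRDFs take values in {0,1,2,3} and form a decidable family.
module Submission where

open import Defs
open import Data.Nat using (ℕ; zero; suc; _+_; _*_; _≤_; _<_; z≤n; s≤s; _≤?_; _≡ᵇ_)
import Data.Nat as ℕ
open import Data.Nat.Properties
  using (≤-refl; ≤-trans; m≤m+n; m≤n+m; +-mono-≤; +-monoʳ-≤; +-comm; +-identityʳ; *-monoʳ-≤;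
         *-distribˡ-+; *-zeroʳ; ≮⇒≥; anyUpTo?; +-commutativeSemigroup)
open import Algebra.Properties.CommutativeSemigroup +-commutativeSemigroup using (interchange)
open import Data.Nat.Induction using (<-wellFounded)
open import Induction.WellFounded using (Acc; acc)
open import Data.Bool using (true; false; if_then_else_)
import Data.Bool as Bool
open import Data.Fin using (Fin; zero; suc)
import Data.Fin as Fin
open import Data.Fin.Properties using (all?; any?; suc-injective)
open import Data.Vec.Functional using (_∷_; tail)
open import Data.Product using (Σ; ∃; ∃-syntax; _×_; _,_; proj₁; proj₂)
open import Data.Sum using (_⊎_; inj₁; inj₂)
open import Data.Empty using (⊥-elim)
open import Function using (_∘_)
open import Relation.Nullary using (Dec; yes; no)
open import Relation.Nullary.Decidable using (map′; _×-dec_; _⊎-dec_; _→-dec_; ¬?)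
open import Relation.Unary using (Decidable)
open import Relation.Binary.PropositionalEquality
  using (_≡_; _≢_; _≗_; refl; trans; cong; cong₂; subst; subst₂; module ≡-Reasoning)
import Relation.Binary.PropositionalEquality as ≡

private
  variable
    n : ℕ

sumF-cong : {f g : Fin n → ℕ} → f ≗ g → sumF f ≡ sumF g
sumF-cong {zero}  f≗g = refl
sumF-cong {suc n} f≗g = cong₂ _+_ (f≗g zero) (sumF-cong (f≗g ∘ suc))

sumF-distrib-+ : (f g : Fin n → ℕ) → sumF (λ i → f i + g i) ≡ sumF f + sumF g
sumF-distrib-+ {zero}  f g = refl
sumF-distrib-+ {suc n} f g =
  trans (cong (f zero + g zero +_) (sumF-distrib-+ (f ∘ suc) (g ∘ suc)))
        (interchange (f zero) (g zero) (sumF (f ∘ suc)) (sumF (g ∘ suc)))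

*-distribˡ-sumF : ∀ c (f : Fin n → ℕ) → sumF (λ i → c * f i) ≡ c * sumF f
*-distribˡ-sumF {zero}  c f = ≡.sym (*-zeroʳ c)
*-distribˡ-sumF {suc n} c f =
  trans (cong (c * f zero +_) (*-distribˡ-sumF c (f ∘ suc)))
        (≡.sym (*-distribˡ-+ c (f zero) (sumF (f ∘ suc))))

f[i]≤sumF : ∀ (f : Fin n → ℕ) i → f i ≤ sumF f
f[i]≤sumF f zero    = m≤m+n _ _
f[i]≤sumF f (suc i) = ≤-trans (f[i]≤sumF (f ∘ suc) i) (m≤n+m _ _)

f[i]+f[j]≤sumF : (f : Fin n → ℕ) {i j : Fin n} → i ≢ j → f i + f j ≤ sumF f
f[i]+f[j]≤sumF f {zero}  {zero}  i≢j = ⊥-elim (i≢j refl)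
f[i]+f[j]≤sumF f {zero}  {suc j} _   = +-monoʳ-≤ (f zero) (f[i]≤sumF (f ∘ suc) j)
f[i]+f[j]≤sumF f {suc i} {zero}  _   =
  subst (_≤ sumF f) (+-comm (f zero) (f (suc i))) (+-monoʳ-≤ (f zero) (f[i]≤sumF (f ∘ suc) i))
f[i]+f[j]≤sumF f {suc i} {suc j} i≢j =
  ≤-trans (f[i]+f[j]≤sumF (f ∘ suc) (i≢j ∘ cong suc)) (m≤n+m _ _)

1≤sumF⇒∃ : (f : Fin n → ℕ) → 1 ≤ sumF f → ∃[ i ] 1 ≤ f i
1≤sumF⇒∃ {suc n} f 1≤Σf with f zero in eq
... | suc _ = zero , subst (1 ≤_) (≡.sym eq) (s≤s z≤n)
... | zero with 1≤sumF⇒∃ (f ∘ suc) 1≤Σf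
...   | i , 1≤fi = suc i , 1≤fi

2≤sumF⇒∃₂ : (f : Fin n → ℕ) → (∀ i → f i ≤ 1) → 2 ≤ sumF f →
            ∃[ i ] ∃[ j ] i ≢ j × 1 ≤ f i × 1 ≤ f j
2≤sumF⇒∃₂ {suc n} f f≤1 2≤Σf with f zero in eq | f≤1 zero
... | zero | _ with 2≤sumF⇒∃₂ (f ∘ suc) (f≤1 ∘ suc) 2≤Σf
...   | i , j , i≢j , 1≤fi , 1≤fj = suc i , suc j , i≢j ∘ suc-injective , 1≤fi , 1≤fj
2≤sumF⇒∃₂ {suc n} f f≤1 (s≤s 1≤Σf) | suc zero | _ with 1≤sumF⇒∃ (f ∘ suc) 1≤Σf
...   | j , 1≤fj = zero , suc j , (λ ()) , subst (1 ≤_) (≡.sym eq) ≤-refl , 1≤fj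
2≤sumF⇒∃₂ {suc n} f f≤1 _ | suc (suc _) | s≤s ()

1≤m+n⇒1≤m⊎1≤n : ∀ m n → 1 ≤ m + n → 1 ≤ m ⊎ 1 ≤ n
1≤m+n⇒1≤m⊎1≤n (suc _) _ _   = inj₁ (s≤s z≤n)
1≤m+n⇒1≤m⊎1≤n zero    _ 1≤n = inj₂ 1≤n

2≤m+2n⇒2≤m⊎1≤n : ∀ m n → 2 ≤ m + 2 * n → 2 ≤ m ⊎ 1 ≤ n
2≤m+2n⇒2≤m⊎1≤n m (suc _) _   = inj₂ (s≤s z≤n)
2≤m+2n⇒2≤m⊎1≤n m zero    2≤m = inj₁ (subst (2 ≤_) (+-identityʳ m) 2≤m)

least-witness : ∀ {p} {Q : ℕ → Set p} → Decidable Q → ∀ {m} → Q m →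
                ∃[ k ] Q k × (∀ {j} → Q j → k ≤ j)
least-witness {Q = Q} Q? = go (<-wellFounded _)
  where
  go : ∀ {m} → Acc _<_ m → Q m → ∃[ k ] Q k × (∀ {j} → Q j → k ≤ j)
  go {m} (acc smaller) qm with anyUpTo? Q? m
  ... | yes (j , j<m , qj) = go (smaller j<m) qj
  ... | no  none           = m , qm , λ qj → ≮⇒≥ (λ j<m → none (_ , j<m , qj))

∃-bounded-function? : ∀ b n {p} {P : (Fin n → ℕ) → Set p} → Decidable P →
             (∀ {f g} → f ≗ g → P f → P g) → (∀ {f} → P f → ∀ i → f i ≤ b) → Dec (∃ P)
∃-bounded-function? b zero    P? resp bounded with P? (λ ())
... | yes p = yes (_ , p)
... | no ¬p = no λ (_ , p) → ¬p (resp (λ ()) p)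
∃-bounded-function? b (suc n) P? resp bounded =
  map′ (λ (a , _ , h , p) → a ∷ h , p)
       (λ (f , p) → f zero , s≤s (bounded p zero) , tail f , resp head∷tail p)
       (anyUpTo? (λ a → ∃-bounded-function? b n (P? ∘ (a ∷_)) (λ h≗g → resp (cons-cong h≗g))
                                       (λ p → bounded p ∘ suc))
                 (suc b))
  where
  head∷tail : ∀ {f : Fin (suc n) → ℕ} → f ≗ f zero ∷ tail f
  head∷tail zero    = refl
  head∷tail (suc i) = refl
  cons-cong : ∀ {a} {h g : Fin n → ℕ} → h ≗ g → a ∷ h ≗ a ∷ g
  cons-cong h≗g zero    = refl
  cons-cong h≗g (suc i) = h≗g i

maskN : Graph n → Fin n → (Fin n → ℕ) → Fin n → ℕ
maskN G v h u = if adj G v u then h u else 0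

module _ (G : Graph n) (v : Fin n) (h : Fin n → ℕ) where

  maskN-∈N : ∀ {u} → u ∈N[ G ] v → maskN G v h u ≡ h u
  maskN-∈N u∈N rewrite u∈N = refl

  maskN-≤ : ∀ u → maskN G v h u ≤ h u
  maskN-≤ u with adj G v u
  ... | true  = ≤-refl
  ... | false = z≤n

  maskN-pos : ∀ {u} → 1 ≤ maskN G v h u → u ∈N[ G ] v × 1 ≤ h u
  maskN-pos {u} 1≤m with adj G v u
  ... | true  = refl , 1≤m

  h≤sumN : ∀ {u} → u ∈N[ G ] v → h u ≤ sumN G v h
  h≤sumN {u} u∈N = subst (_≤ sumN G v h) (maskN-∈N u∈N) (f[i]≤sumF (maskN G v h) u)

  h+h≤sumN : ∀ {u w} → u ≢ w → u ∈N[ G ] v → w ∈N[ G ] v → h u + h w ≤ sumN G v h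
  h+h≤sumN u≢w u∈N w∈N =
    subst₂ (λ a b → a + b ≤ sumN G v h) (maskN-∈N u∈N) (maskN-∈N w∈N) (f[i]+f[j]≤sumF (maskN G v h) u≢w)

  1≤sumN⇒∃ : 1 ≤ sumN G v h → ∃[ u ] u ∈N[ G ] v × 1 ≤ h u
  1≤sumN⇒∃ 1≤Σ with 1≤sumF⇒∃ (maskN G v h) 1≤Σ
  ... | u , 1≤mu = u , maskN-pos 1≤mu

  2≤sumN⇒∃₂ : (∀ u → h u ≤ 1) → 2 ≤ sumN G v h →
              ∃[ u ] ∃[ w ] u ≢ w × u ∈N[ G ] v × w ∈N[ G ] v × 1 ≤ h u × 1 ≤ h w
  2≤sumN⇒∃₂ h≤1 2≤Σ with 2≤sumF⇒∃₂ (maskN G v h) (λ u → ≤-trans (maskN-≤ u) (h≤1 u)) 2≤Σ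
  ... | u , w , u≢w , 1≤mu , 1≤mw with maskN-pos 1≤mu | maskN-pos 1≤mw
  ... | u∈N , 1≤hu | w∈N , 1≤hw = u , w , u≢w , u∈N , w∈N , 1≤hu , 1≤hw

data Encodes : ℕ → ℕ → ℕ → ℕ → Set where
  enc₀ : Encodes 0 0 0 0
  enc₁ : Encodes 1 1 0 0
  enc₂ : Encodes 2 0 1 0
  enc₃ : Encodes 3 0 0 1

[_≡ᵇ_] : ℕ → ℕ → ℕ
[ a ≡ᵇ k ] = if a ≡ᵇ k then 1 else 0

encodes-indicators : ∀ {a} → a ≤ 3 → Encodes a [ a ≡ᵇ 1 ] [ a ≡ᵇ 2 ] [ a ≡ᵇ 3 ]
encodes-indicators {0} _ = enc₀
encodes-indicators {1} _ = enc₁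
encodes-indicators {2} _ = enc₂
encodes-indicators {3} _ = enc₃
encodes-indicators {suc (suc (suc (suc _)))} (s≤s (s≤s (s≤s ())))

encodes-value : ∀ {x y z} → x + y + z ≤ 1 → Encodes (x + 2 * y + 3 * z) x y z
encodes-value {0} {0} {0} _ = enc₀
encodes-value {1} {0} {0} _ = enc₁
encodes-value {0} {1} {0} _ = enc₂
encodes-value {0} {0} {1} _ = enc₃
encodes-value {0} {0} {suc (suc _)} (s≤s ())
encodes-value {0} {1} {suc _} (s≤s ())
encodes-value {0} {suc (suc _)} (s≤s ())
encodes-value {1} {suc _} (s≤s ())
encodes-value {1} {0} {suc _} (s≤s ())
encodes-value {suc (suc _)} (s≤s ())

module _ {a x y z : ℕ} where

  encodes-≡ : Encodes a x y z → a ≡ x + 2 * y + 3 * z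
  encodes-≡ enc₀ = refl
  encodes-≡ enc₁ = refl
  encodes-≡ enc₂ = refl
  encodes-≡ enc₃ = refl

  encodes-≤3 : Encodes a x y z → a ≤ 3
  encodes-≤3 enc₀ = z≤n
  encodes-≤3 enc₁ = s≤s z≤n
  encodes-≤3 enc₂ = s≤s (s≤s z≤n)
  encodes-≤3 enc₃ = ≤-refl

  encodes-one-hot : Encodes a x y z → x + y + z ≤ 1
  encodes-one-hot enc₀ = z≤n
  encodes-one-hot enc₁ = ≤-refl
  encodes-one-hot enc₂ = ≤-refl
  encodes-one-hot enc₃ = ≤-refl

  encodes-binary : Encodes a x y z → x ≤ 1 × y ≤ 1 × z ≤ 1
  encodes-binary enc₀ = z≤n , z≤n , z≤n
  encodes-binary enc₁ = ≤-refl , z≤n , z≤n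
  encodes-binary enc₂ = z≤n , ≤-refl , z≤n
  encodes-binary enc₃ = z≤n , z≤n , ≤-refl

  encodes-zero : Encodes a x y z → a ≡ 0 → x + y + z ≡ 0
  encodes-zero enc₀ _ = refl

  encodes-nonzero : Encodes a x y z → a ≡ 0 ⊎ x + y + z ≡ 1
  encodes-nonzero enc₀ = inj₁ refl
  encodes-nonzero enc₁ = inj₂ refl
  encodes-nonzero enc₂ = inj₂ refl
  encodes-nonzero enc₃ = inj₂ refl

  encodes-x : Encodes a x y z → a ≡ 1 ⊎ x ≡ 0
  encodes-x enc₀ = inj₂ refl
  encodes-x enc₁ = inj₁ refl
  encodes-x enc₂ = inj₂ refl
  encodes-x enc₃ = inj₂ refl

  encodes-1 : Encodes a x y z → a ≡ 1 → x ≡ 1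
  encodes-1 enc₁ _ = refl

  encodes-2 : Encodes a x y z → a ≡ 2 → y ≡ 1
  encodes-2 enc₂ _ = refl

  encodes-3 : Encodes a x y z → a ≡ 3 → z ≡ 1
  encodes-3 enc₃ _ = refl

  encodes-y : Encodes a x y z → 1 ≤ y → a ≡ 2
  encodes-y enc₂ _ = refl

  encodes-z : Encodes a x y z → 1 ≤ z → a ≡ 3
  encodes-z enc₃ _ = refl

  encodes-≥2 : Encodes a x y z → 2 ≤ a → 1 ≤ y + z
  encodes-≥2 enc₁ (s≤s ())
  encodes-≥2 enc₂ _        = s≤s z≤n
  encodes-≥2 enc₃ _        = s≤s z≤n

ZeroCondition OneCondition : Graph n → (Fin n → ℕ) → Fin n → Set
ZeroCondition {n} G f v =
  (Σ (Fin n) λ u → Σ (Fin n) λ w → u ≢ w × u ∈N[ G ] v × w ∈N[ G ] v × f u ≡ 2 × f w ≡ 2)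
  ⊎ (Σ (Fin n) λ u → u ∈N[ G ] v × f u ≡ 3)
OneCondition {n} G f v = Σ (Fin n) λ u → u ∈N[ G ] v × 2 ≤ f u

module Correspondence (G : Graph n) {f x y z : Fin n → ℕ}
                      (enc : ∀ v → Encodes (f v) (x v) (y v) (z v)) where

  private
    Y Z : Fin n → ℕ
    Y v = sumN G v y
    Z v = sumN G v z

  IsDRDF⇒Feasible : IsDRDF G f → Feasible G x y z
  IsDRDF⇒Feasible D = record
    { x-bin = λ v → proj₁ (encodes-binary (enc v))
    ; y-bin = λ v → proj₁ (proj₂ (encodes-binary (enc v)))
    ; z-bin = λ v → proj₂ (proj₂ (encodes-binary (enc v)))
    ; c1    = c1
    ; c2    = c2
    ; c3    = λ v → encodes-one-hot (enc v)
    }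
    where
    open IsDRDF D

    dominated : ∀ v → f v ≡ 0 → 2 ≤ Y v + 2 * Z v
    dominated v fv≡0 with zero-cond v fv≡0
    ... | inj₁ (u , w , u≢w , u∈N , w∈N , fu≡2 , fw≡2) =
      ≤-trans (subst₂ (λ a b → a + b ≤ Y v) (encodes-2 (enc u) fu≡2) (encodes-2 (enc w) fw≡2)
                      (h+h≤sumN G v y u≢w u∈N w∈N))
              (m≤m+n (Y v) (2 * Z v))
    ... | inj₂ (u , u∈N , fu≡3) =
      ≤-trans (*-monoʳ-≤ 2 (subst (_≤ Z v) (encodes-3 (enc u) fu≡3) (h≤sumN G v z u∈N)))
              (m≤n+m (2 * Z v) (Y v))

    c1 : ∀ v → 2 ≤ 2 * (x v + y v + z v) + Y v + 2 * Z v
    c1 v with encodes-nonzero (enc v)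
    ... | inj₁ fv≡0 = subst (λ s → 2 ≤ 2 * s + Y v + 2 * Z v)
                            (≡.sym (encodes-zero (enc v) fv≡0)) (dominated v fv≡0)
    ... | inj₂ one  = subst (λ s → 2 ≤ 2 * s + Y v + 2 * Z v) (≡.sym one) (s≤s (s≤s z≤n))

    c2 : ∀ v → x v ≤ Y v + Z v
    c2 v with encodes-x (enc v)
    ... | inj₂ xv≡0 = subst (_≤ Y v + Z v) (≡.sym xv≡0) z≤n
    ... | inj₁ fv≡1 with one-cond v fv≡1
    ...   | u , u∈N , 2≤fu =
      subst (_≤ Y v + Z v) (≡.sym (encodes-1 (enc v) fv≡1))
        (≤-trans (encodes-≥2 (enc u) 2≤fu) (+-mono-≤ (h≤sumN G v y u∈N) (h≤sumN G v z u∈N)))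

  Feasible⇒IsDRDF : Feasible G x y z → IsDRDF G f
  Feasible⇒IsDRDF F = record
    { range     = λ v → encodes-≤3 (enc v)
    ; zero-cond = zero-cond
    ; one-cond  = one-cond
    }
    where
    open Feasible F

    zero-cond : ∀ v → f v ≡ 0 → ZeroCondition G f v
    zero-cond v fv≡0
      with 2≤m+2n⇒2≤m⊎1≤n (Y v) (Z v)
             (subst (λ s → 2 ≤ 2 * s + Y v + 2 * Z v) (encodes-zero (enc v) fv≡0) (c1 v))
    ... | inj₂ 1≤Zv with 1≤sumN⇒∃ G v z 1≤Zv
    ...   | u , u∈N , 1≤zu = inj₂ (u , u∈N , encodes-z (enc u) 1≤zu)
    zero-cond v fv≡0 | inj₁ 2≤Yv with 2≤sumN⇒∃₂ G v y y-bin 2≤Yv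
    ...   | u , w , u≢w , u∈N , w∈N , 1≤yu , 1≤yw =
      inj₁ (u , w , u≢w , u∈N , w∈N , encodes-y (enc u) 1≤yu , encodes-y (enc w) 1≤yw)

    one-cond : ∀ v → f v ≡ 1 → OneCondition G f v
    one-cond v fv≡1
      with 1≤m+n⇒1≤m⊎1≤n (Y v) (Z v) (subst (_≤ Y v + Z v) (encodes-1 (enc v) fv≡1) (c2 v))
    ... | inj₁ 1≤Yv with 1≤sumN⇒∃ G v y 1≤Yv
    ...   | u , u∈N , 1≤yu = u , u∈N , subst (2 ≤_) (≡.sym (encodes-y (enc u) 1≤yu)) ≤-refl
    one-cond v fv≡1 | inj₂ 1≤Zv with 1≤sumN⇒∃ G v z 1≤Zv
    ...   | u , u∈N , 1≤zu = u , u∈N , subst (2 ≤_) (≡.sym (encodes-z (enc u) 1≤zu)) (s≤s (s≤s z≤n))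

weight≡objective : {f x y z : Fin n → ℕ} → (∀ v → Encodes (f v) (x v) (y v) (z v)) →
                   weight f ≡ objective x y z
weight≡objective {f = f} {x} {y} {z} enc = begin
  sumF f
    ≡⟨ sumF-cong (encodes-≡ ∘ enc) ⟩
  sumF (λ v → x v + 2 * y v + 3 * z v)
    ≡⟨ sumF-distrib-+ (λ v → x v + 2 * y v) (λ v → 3 * z v) ⟩
  sumF (λ v → x v + 2 * y v) + sumF (λ v → 3 * z v)
    ≡⟨ cong₂ _+_ (sumF-distrib-+ x (λ v → 2 * y v)) (*-distribˡ-sumF 3 z) ⟩
  sumF x + sumF (λ v → 2 * y v) + 3 * sumF z
    ≡⟨ cong (λ s → sumF x + s + 3 * sumF z) (*-distribˡ-sumF 2 y) ⟩
  sumF x + 2 * sumF y + 3 * sumF z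
    ∎
  where open ≡-Reasoning

module _ (G : Graph n) where

  ∈N? : ∀ u v → Dec (u ∈N[ G ] v)
  ∈N? u v = adj G v u Bool.≟ true

  zeroCondition? : ∀ f v → Dec (ZeroCondition G f v)
  zeroCondition? f v =
    any? (λ u → any? (λ w → ¬? (u Fin.≟ w) ×-dec ∈N? u v ×-dec ∈N? w v ×-dec
                             f u ℕ.≟ 2 ×-dec f w ℕ.≟ 2))
    ⊎-dec any? (λ u → ∈N? u v ×-dec f u ℕ.≟ 3)

  oneCondition? : ∀ f v → Dec (OneCondition G f v)
  oneCondition? f v = any? (λ u → ∈N? u v ×-dec 2 ≤? f u)

  isDRDF? : ∀ f → Dec (IsDRDF G f)
  isDRDF? f =
    map′ (λ (r , z , o) → record { range = r ; zero-cond = z ; one-cond = o })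
         (λ D → IsDRDF.range D , IsDRDF.zero-cond D , IsDRDF.one-cond D)
         (all? (λ v → f v ≤? 3)
          ×-dec all? (λ v → f v ℕ.≟ 0 →-dec zeroCondition? f v)
          ×-dec all? (λ v → f v ℕ.≟ 1 →-dec oneCondition? f v))

  IsDRDF-resp-≗ : {f g : Fin n → ℕ} → f ≗ g → IsDRDF G f → IsDRDF G g
  IsDRDF-resp-≗ {f} {g} f≗g D = record
    { range     = λ v → subst (_≤ 3) (f≗g v) (range v)
    ; zero-cond = λ v gv≡0 → zero-resp v (zero-cond v (trans (f≗g v) gv≡0))
    ; one-cond  = λ v gv≡1 → one-resp v (one-cond v (trans (f≗g v) gv≡1))
    }
    where
    open IsDRDF D
    f≡→g≡ : ∀ {u k} → f u ≡ k → g u ≡ k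
    f≡→g≡ {u} = trans (≡.sym (f≗g u))

    zero-resp : ∀ v → ZeroCondition G f v → ZeroCondition G g v
    zero-resp v (inj₁ (u , w , u≢w , u∈N , w∈N , fu≡2 , fw≡2)) =
      inj₁ (u , w , u≢w , u∈N , w∈N , f≡→g≡ fu≡2 , f≡→g≡ fw≡2)
    zero-resp v (inj₂ (u , u∈N , fu≡3)) = inj₂ (u , u∈N , f≡→g≡ fu≡3)

    one-resp : ∀ v → OneCondition G f v → OneCondition G g v
    one-resp v (u , u∈N , 2≤fu) = u , u∈N , subst (2 ≤_) (f≗g u) 2≤fu

  const2-isDRDF : IsDRDF G (λ _ → 2)
  const2-isDRDF = record { range = λ _ → s≤s (s≤s z≤n) ; zero-cond = λ _ () ; one-cond = λ _ () }

  weightAttained? : Decidable λ k → ∃ λ f → IsDRDF G f × weight f ≡ k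
  weightAttained? k =
    ∃-bounded-function? 3 n (λ f → isDRDF? f ×-dec weight f ℕ.≟ k)
      (λ f≗g (D , wf≡k) → IsDRDF-resp-≗ f≗g D , trans (≡.sym (sumF-cong f≗g)) wf≡k)
      (λ (D , _) → IsDRDF.range D)

drdNumber-exists : (G : Graph n) → ∃ (IsDRDNumber G)
drdNumber-exists G =
  let k , attained , least = least-witness (weightAttained? G) (_ , const2-isDRDF G , refl)
  in  k , attained , λ f D → least (f , D , refl)

drdNumber⇒ilpOptimum : (G : Graph n) {k : ℕ} → IsDRDNumber G k → IsILPOptimum G k
drdNumber⇒ilpOptimum {n} G {k} ((f , D , wf≡k) , least) =
  (x , y , z , IsDRDF⇒Feasible G enc D , trans (≡.sym (weight≡objective enc)) wf≡k) , lower-bound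
  where
  open Correspondence using (IsDRDF⇒Feasible; Feasible⇒IsDRDF)
  x y z : Fin n → ℕ
  x v = [ f v ≡ᵇ 1 ]
  y v = [ f v ≡ᵇ 2 ]
  z v = [ f v ≡ᵇ 3 ]
  enc : ∀ v → Encodes (f v) (x v) (y v) (z v)
  enc v = encodes-indicators (IsDRDF.range D v)

  lower-bound : ∀ x y z → Feasible G x y z → k ≤ objective x y z
  lower-bound x y z F =
    subst (k ≤_) (weight≡objective decoded) (least _ (Feasible⇒IsDRDF G decoded F))
    where
    decoded : ∀ v → Encodes (x v + 2 * y v + 3 * z v) (x v) (y v) (z v)
    decoded v = encodes-value (Feasible.c3 F v)

theorem1 : ∀ {n} (G : Graph n) →
    Σ ℕ λ k → IsILPOptimum G k × IsDRDNumber G k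
theorem1 G with drdNumber-exists G
... | k , γ = k , drdNumber⇒ilpOptimum G γ , γ
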